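{- Let $A(x)=\sum_{n\ge 0}|\mathfrak D^1_{2n}(4213)|x^n$ and $B(x)=\sum_{n\ge 0}|\mathfrak D^1_{2n}(1342)|x^n$ be the ordinary generating functions. Then $A(x)=\dfrac{1}{1-xB(x)}$.
   Context: A permutation $\sigma\in\mathfrak S_m$ contains a pattern $\tau\in\mathfrak S_k$ if $\sigma$ has a subsequence $(\sigma(i_1),\dots,\sigma(i_k))$, $i_1<\dots<i_k$, order-isomorphic to $\tau$; otherwise $\sigma$ avoids $\tau$. A Dumont permutation of the first kind of length $2n$ is a permutation $\pi\in\mathfrak S_{2n}$ such that for every $i$: if $\pi(i)$ is even then $i<2n$ and $\pi(i)>\pi(i+1)$; if $\pi(i)$ is odd then $i=2n$ or $\pi(i)<\pi(i+1)$. For $n=0$ the empty permutation is the unique such permutation. $\mathfrak D^1_{2n}(\tau)$ denotes the set of such permutations avoiding $\tau$. -}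

module Defs where

open import Data.Nat using (ℕ; zero; suc; _+_; _*_; _∸_; _<ᵇ_; _≡ᵇ_)
open import Data.Bool using (Bool; true; false; _∧_; _∨_; not; if_then_else_)
open import Data.List using (List; []; _∷_; _++_; map; length; all; any; filterᵇ; upTo; concatMap; sum)

-- Permutations of [1..m] are represented in one-line notation as lists of
-- naturals  (π(1), …, π(m)); positions are 0-indexed internally.

-- i-th entry (0-indexed); out of range gives 0 (never used in range checks).
at : List ℕ → ℕ → ℕ
at []       _       = 0
at (x ∷ _)  zero    = x
at (_ ∷ xs) (suc i) = at xs i

evenᵇ : ℕ → Bool
evenᵇ zero          = true
evenᵇ (suc zero)    = false
evenᵇ (suc (suc n)) = evenᵇ n

boolEq : Bool → Bool → Bool
boolEq true  b = b
boolEq false b = not b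

words : ℕ → ℕ → List (List ℕ)
words m zero    = [] ∷ []
words m (suc k) = concatMap (λ v → map (v ∷_) (words m k)) (map suc (upTo m))

countᵇ : ℕ → List ℕ → ℕ
countᵇ v w = length (filterᵇ (λ x → x ≡ᵇ v) w)

isPerm : ℕ → List ℕ → Bool
isPerm m w = (length w ≡ᵇ m) ∧ all (λ v → countᵇ v w ≡ᵇ 1) (map suc (upTo m))

-- Dumont condition of the first kind, for a permutation of [1..m]:
-- π(i) even ⇒ i < m and π(i) > π(i+1);  π(i) odd ⇒ i = m or π(i) < π(i+1)
-- (here with 0-indexed position i, so "i = m" becomes "i+1 = m").
isDumont1 : ℕ → List ℕ → Bool
isDumont1 m w = all cond (upTo m)
  where
  cond : ℕ → Bool
  cond i = if evenᵇ (at w i)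
           then ((suc i <ᵇ m) ∧ (at w (suc i) <ᵇ at w i))
           else ((suc i ≡ᵇ m) ∨ (at w i <ᵇ at w (suc i)))

subseqs : List ℕ → List (List ℕ)
subseqs []       = [] ∷ []
subseqs (x ∷ xs) = map (x ∷_) (subseqs xs) ++ subseqs xs

orderIso : List ℕ → List ℕ → Bool
orderIso s t = (length s ≡ᵇ length t)
  ∧ all (λ i → all (λ j → boolEq (at s i <ᵇ at s j) (at t i <ᵇ at t j))
                   (upTo (length s)))
        (upTo (length s))

contains : List ℕ → List ℕ → Bool
contains τ σ = any (λ s → orderIso s τ) (subseqs σ)

avoids : List ℕ → List ℕ → Bool
avoids τ σ = not (contains τ σ)

dumont1Count : List ℕ → ℕ → ℕ
dumont1Count τ n =
  length (filterᵇ (λ w → isPerm (2 * n) w ∧ isDumont1 (2 * n) w ∧ avoids τ w)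
                  (words (2 * n) (2 * n)))

aSeq : ℕ → ℕ
aSeq = dumont1Count (4 ∷ 2 ∷ 1 ∷ 3 ∷ [])

bSeq : ℕ → ℕ
bSeq = dumont1Count (1 ∷ 3 ∷ 4 ∷ 2 ∷ [])

{-# OPTIONS --safe #-}

-- Write N = 2n + 2.  In a Dumont permutation of 1, …, N the even letter 2 must descend, so it
-- is followed by 1: π = L 2 1 R.  If π avoids 4213, every letter of L is below every letter
-- of R (else x 2 1 y is a 4213), so L is a permutation of 3, …, j and R one of j + 1, …, N,
-- with j = |L| + 2.  Moreover j is even, for otherwise the even letter j + 1, the least letter
-- of R, would have to be followed by a smaller one.  With |L| = 2k, the complement
-- x ↦ 2k + 3 − x turns L, whose last letter descends to 2 and so is even, into a 1342-avoiding
-- Dumont permutation of 1, …, 2k, and R − (2k + 2) is a 4213-avoiding Dumont permutation of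
-- 1, …, 2(n − k).  This decomposition is a bijection, so a_{n+1} = Σ_k b_k a_{n−k}, which is
-- A = 1 + xBA.

module Submission where

open import Defs
open import Data.Bool using (Bool; true; false; not; T; _∧_; _∨_; if_then_else_)
open import Data.Bool.Properties using (T-∧; ¬-not)
open import Data.Empty using (⊥; ⊥-elim)
open import Data.Unit using (⊤)
open import Data.List
  using (List; []; _∷_; _++_; map; length; upTo; concatMap; all; filterᵇ; sum; cartesianProductWith)
open import Data.List.Properties
  using (++-assoc; length-map; length-++; length-++-≤ˡ; length-++-sucʳ; length-upTo; map-upTo; map-cong;
         ∷-injective; ∷-injectiveˡ; ∷-injectiveʳ; filter-accept; filter-reject)
open import Data.List.Membership.Propositional using (_∈_; _∉_; find; lose)
open import Data.List.Membership.Propositional.Properties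
  using (∈-map⁺; ∈-map⁻; ∈-++⁺ˡ; ∈-++⁺ʳ; ∈-++⁻; ∈-∃++; ∈-upTo⁺; ∈-upTo⁻; ∈-concatMap⁺; ∈-concatMap⁻;
         ∈-filter⁺; ∈-filter⁻; ∈-cartesianProductWith⁺; ∈-cartesianProductWith⁻)
open import Data.List.Relation.Unary.All as All using (All; []; _∷_)
import Data.List.Relation.Unary.All.Properties as AllP
open import Data.List.Relation.Unary.Any using (here; there)
import Data.List.Relation.Unary.Any.Properties as AnyP
open import Data.List.Relation.Unary.AllPairs using (AllPairs; []; _∷_)
open import Data.List.Relation.Unary.Linked using ([-]; _∷_)
open import Data.List.Relation.Unary.Linked.Properties using (Linked⇒AllPairs)
open import Data.List.Relation.Unary.Unique.Propositional using (Unique)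
import Data.List.Relation.Unary.Unique.Propositional.Properties as Unique
open import Data.List.Relation.Binary.Sublist.Propositional
  using (_⊆_; []; _∷_; _∷ʳ_; ⊆-refl; ⊆-trans; from∈) renaming (lookup to ⊆-lookup)
import Data.List.Relation.Binary.Sublist.Propositional.Properties as ⊆
open import Data.List.Relation.Binary.Pointwise using (Pointwise; []; _∷_)
open import Data.Nat
  using (ℕ; zero; suc; pred; _+_; _*_; _∸_; _≤_; _<_; _≰_; _≤?_; _<?_; z≤n; s≤s; s≤s⁻¹; s<s⁻¹; z<s;
         _<ᵇ_; _≡ᵇ_)
open import Data.Nat.Properties
open import Data.List.Membership.DecPropositional _≟_ using (_∈?_)
open import Data.Product using (∃; _×_; _,_; proj₁; proj₂)
open import Data.Product.Function.NonDependent.Propositional using (_×-⇔_)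
open import Data.Sum using (_⊎_; inj₁; inj₂; [_,_]′)
open import Function using (id; _∘_; _⇔_; mk⇔; Equivalence; case_of_)
import Function.Properties.Equivalence as ⇔
open import Relation.Nullary using (¬_; Dec; yes; no; contradiction)
open import Relation.Nullary.Decidable using (T?; from-yes; _×-dec_)
open import Relation.Binary.Definitions using (tri<; tri≈; tri>)
open import Relation.Binary.PropositionalEquality
  using (_≡_; _≢_; refl; sym; trans; cong; cong₂; subst; subst₂; module ≡-Reasoning)

private
  variable
    A B C : Set
    x y v : A
    xs ys : List A
    m n : ℕ

pigeonhole : Unique xs → (∀ {x} → x ∈ xs → x ∈ ys) → length xs ≤ length ys
pigeonhole {xs = []} _ _ = z≤n
pigeonhole {xs = x ∷ xs} {ys} (x∉ ∷ u) xs⊆ys with ∈-∃++ (xs⊆ys (here refl))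
... | ys₁ , ys₂ , refl = begin
  suc (length xs)          ≤⟨ s≤s (pigeonhole u delete) ⟩
  suc (length (ys₁ ++ ys₂)) ≡⟨ length-++-sucʳ ys₁ x ys₂ ⟨
  length (ys₁ ++ x ∷ ys₂)  ∎
  where
  open ≤-Reasoning
  delete : ∀ {y} → y ∈ xs → y ∈ ys₁ ++ ys₂
  delete y∈ with ∈-++⁻ ys₁ (xs⊆ys (there y∈))
  ... | inj₁ y∈ys₁         = ∈-++⁺ˡ y∈ys₁
  ... | inj₂ (there y∈ys₂) = ∈-++⁺ʳ ys₁ y∈ys₂
  ... | inj₂ (here refl)   = contradiction refl (All.lookup x∉ y∈)

Unique-++⁻ˡ : ∀ xs → Unique (xs ++ ys) → Unique xs
Unique-++⁻ˡ []       _         = []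
Unique-++⁻ˡ (x ∷ xs) (x∉ ∷ u) = AllP.++⁻ˡ xs x∉ ∷ Unique-++⁻ˡ xs u

Unique-++⁻ʳ : ∀ xs → Unique (xs ++ ys) → Unique ys
Unique-++⁻ʳ []       u       = u
Unique-++⁻ʳ (x ∷ xs) (_ ∷ u) = Unique-++⁻ʳ xs u

Unique-++⁻-disjoint : ∀ xs → Unique (xs ++ ys) → v ∈ xs → v ∉ ys
Unique-++⁻-disjoint (x ∷ xs) (x∉ ∷ _) (here refl) v∈ys = All.lookup (AllP.++⁻ʳ xs x∉) v∈ys refl
Unique-++⁻-disjoint (x ∷ xs) (_ ∷ u)  (there v∈)  v∈ys = Unique-++⁻-disjoint xs u v∈ v∈ys

Unique-map⁺-on : {f : A → B} → (∀ {x y} → x ∈ xs → y ∈ xs → f x ≡ f y → x ≡ y) →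
                 Unique xs → Unique (map f xs)
Unique-map⁺-on {xs = []}     _   _         = []
Unique-map⁺-on {xs = x ∷ xs} inj (x∉ ∷ u) =
  AllP.map⁺ (All.tabulate λ y∈ fx≡fy → All.lookup x∉ y∈ (inj (here refl) (there y∈) fx≡fy))
  ∷ Unique-map⁺-on (λ x∈ y∈ → inj (there x∈) (there y∈)) u

Unique-concatMap⁺ : {f : A → List B} → Unique xs → (∀ {x} → x ∈ xs → Unique (f x)) →
                    (∀ {x y z} → x ∈ xs → y ∈ xs → z ∈ f x → z ∈ f y → x ≡ y) →
                    Unique (concatMap f xs)
Unique-concatMap⁺ {xs = []}     _         _      _        = []
Unique-concatMap⁺ {xs = x ∷ xs} {f = f} (x∉ ∷ u) unique disjoint =
  Unique.++⁺ (unique (here refl))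
             (Unique-concatMap⁺ u (unique ∘ there) (λ x∈ y∈ → disjoint (there x∈) (there y∈)))
             apart
  where
  apart : ∀ {z} → ¬ (z ∈ f x × z ∈ concatMap f xs)
  apart (z∈fx , z∈rest) with find (∈-concatMap⁻ f z∈rest)
  ... | y , y∈xs , z∈fy = All.lookup x∉ y∈xs (disjoint (here refl) (there y∈xs) z∈fx z∈fy)

Unique-cartesianProductWith⁺ : ∀ {f : A → B → C} {xs ys} →
  (∀ {a a′ b b′} → a ∈ xs → a′ ∈ xs → b ∈ ys → b′ ∈ ys → f a b ≡ f a′ b′ → a ≡ a′ × b ≡ b′) →
  Unique xs → Unique ys → Unique (cartesianProductWith f xs ys)
Unique-cartesianProductWith⁺ {xs = []} _ _ _ = []
Unique-cartesianProductWith⁺ {f = f} {x ∷ xs} {ys} inj (x∉ ∷ ux) uy =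
  Unique.++⁺ (Unique-map⁺-on (λ b∈ b′∈ → proj₂ ∘ inj (here refl) (here refl) b∈ b′∈) uy)
             (Unique-cartesianProductWith⁺ (λ a∈ a′∈ → inj (there a∈) (there a′∈)) ux uy)
             apart
  where
  apart : ∀ {v} → ¬ (v ∈ map (f x) ys × v ∈ cartesianProductWith f xs ys)
  apart (v∈ , v∈′) with ∈-map⁻ (f x) v∈ | ∈-cartesianProductWith⁻ f xs ys v∈′
  ... | b , b∈ , refl | a , b′ , a∈ , b′∈ , eq =
    All.lookup x∉ a∈ (proj₁ (inj (here refl) (there a∈) b∈ b′∈ eq))

length-concatMap : ∀ (f : A → List B) xs → length (concatMap f xs) ≡ sum (map (length ∘ f) xs)
length-concatMap f []       = refl
length-concatMap f (x ∷ xs) = trans (length-++ (f x)) (cong (length (f x) +_) (length-concatMap f xs))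

length-cartesianProductWith : ∀ (f : A → B → C) xs ys →
                              length (cartesianProductWith f xs ys) ≡ length xs * length ys
length-cartesianProductWith f []       ys = refl
length-cartesianProductWith f (x ∷ xs) ys =
  trans (length-++ (map (f x) ys)) (cong₂ _+_ (length-map (f x) ys) (length-cartesianProductWith f xs ys))

++-∷-injective : ∀ {x : A} xs xs′ {ys ys′} → x ∉ xs → x ∉ xs′ →
                 xs ++ x ∷ ys ≡ xs′ ++ x ∷ ys′ → xs ≡ xs′ × ys ≡ ys′
++-∷-injective []       []         _   _    eq = refl , ∷-injectiveʳ eq
++-∷-injective []       (_ ∷ _)    _   x∉′ eq = contradiction (here (∷-injectiveˡ eq)) x∉′
++-∷-injective (_ ∷ _)  []         x∉  _    eq = contradiction (here (sym (∷-injectiveˡ eq))) x∉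
++-∷-injective (y ∷ xs) (y′ ∷ xs′) x∉  x∉′ eq with ∷-injective eq
... | refl , eq′ =
  let xs≡ , ys≡ = ++-∷-injective xs xs′ (x∉ ∘ there) (x∉′ ∘ there) eq′ in cong (y ∷_) xs≡ , ys≡

⊆-++⁻ : ∀ (xs : List A) {ys s} → s ⊆ xs ++ ys → ∃ λ s₁ → ∃ λ s₂ → s ≡ s₁ ++ s₂ × s₁ ⊆ xs × s₂ ⊆ ys
⊆-++⁻ []       s⊆          = [] , _ , refl , [] , s⊆
⊆-++⁻ (x ∷ xs) (_ ∷ʳ s⊆)   =
  let s₁ , s₂ , eq , s₁⊆ , s₂⊆ = ⊆-++⁻ xs s⊆ in s₁ , s₂ , eq , x ∷ʳ s₁⊆ , s₂⊆
⊆-++⁻ (x ∷ xs) (refl ∷ s⊆) =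
  let s₁ , s₂ , eq , s₁⊆ , s₂⊆ = ⊆-++⁻ xs s⊆ in x ∷ s₁ , s₂ , cong (x ∷_) eq , refl ∷ s₁⊆ , s₂⊆

⊆-map⁻ : ∀ (f : A → B) {w s} → s ⊆ map f w → ∃ λ s′ → s′ ⊆ w × Pointwise (λ y x → y ≡ f x) s s′
⊆-map⁻ f {[]}    []           = [] , [] , []
⊆-map⁻ f {x ∷ w} (_ ∷ʳ s⊆)    = let s′ , s′⊆ , pw = ⊆-map⁻ f s⊆ in s′ , x ∷ʳ s′⊆ , pw
⊆-map⁻ f {x ∷ w} (refl ∷ s⊆)  = let s′ , s′⊆ , pw = ⊆-map⁻ f s⊆ in x ∷ s′ , refl ∷ s′⊆ , refl ∷ pw

all-map : ∀ (p : B → Bool) (f : A → B) xs → all p (map f xs) ≡ all (p ∘ f) xs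
all-map p f []       = refl
all-map p f (x ∷ xs) = cong (p (f x) ∧_) (all-map p f xs)

subst-⇔ : ∀ (P : A → Set) {x y} → x ≡ y → P x ⇔ P y
subst-⇔ P refl = ⇔.refl

evenᵇ-suc : ∀ n → evenᵇ (suc n) ≡ not (evenᵇ n)
evenᵇ-suc zero          = refl
evenᵇ-suc (suc zero)    = refl
evenᵇ-suc (suc (suc n)) = evenᵇ-suc n

evenᵇ-+ : ∀ m n → evenᵇ (m + n) ≡ boolEq (evenᵇ m) (evenᵇ n)
evenᵇ-+ zero          n = refl
evenᵇ-+ (suc zero)    n = evenᵇ-suc n
evenᵇ-+ (suc (suc m)) n = evenᵇ-+ m n

evenᵇ-+-even : ∀ m {n} → evenᵇ n ≡ true → evenᵇ (m + n) ≡ evenᵇ m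
evenᵇ-+-even zero          n-even = n-even
evenᵇ-+-even (suc zero)    {n} n-even = trans (evenᵇ-suc n) (cong not n-even)
evenᵇ-+-even (suc (suc m)) n-even = evenᵇ-+-even m n-even

evenᵇ-∸-odd : ∀ {M} x → evenᵇ M ≡ false → x ≤ M → evenᵇ (M ∸ x) ≡ not (evenᵇ x)
evenᵇ-∸-odd {M} x M-odd x≤M =
  boolEq≡false (trans (sym (evenᵇ-+ (M ∸ x) x)) (trans (cong evenᵇ (m∸n+n≡m x≤M)) M-odd))
  where
  boolEq≡false : ∀ {a b} → boolEq a b ≡ false → a ≡ not b
  boolEq≡false {true}  {false} _ = refl
  boolEq≡false {false} {true}  _ = refl

evenᵇ-2* : ∀ k → evenᵇ (2 * k) ≡ true
evenᵇ-2* zero    = refl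
evenᵇ-2* (suc k) = trans (cong evenᵇ (*-suc 2 k)) (evenᵇ-2* k)

evenᵇ-1+2* : ∀ k → evenᵇ (suc (2 * k)) ≡ false
evenᵇ-1+2* k = trans (evenᵇ-suc (2 * k)) (cong not (evenᵇ-2* k))

evenᵇ⇒2* : ∀ n → evenᵇ n ≡ true → ∃ λ k → n ≡ 2 * k
evenᵇ⇒2* zero          _      = 0 , refl
evenᵇ⇒2* (suc (suc n)) n-even with evenᵇ⇒2* n n-even
... | k , refl = suc k , sym (*-suc 2 k)

-- Permutations of an interval

oneTo : ℕ → List ℕ
oneTo m = map suc (upTo m)

∈-oneTo⁺ : 0 < v → v ≤ m → v ∈ oneTo m
∈-oneTo⁺ {suc i} _ i<m = ∈-map⁺ suc (∈-upTo⁺ i<m)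

∈-oneTo⁻ : v ∈ oneTo m → 0 < v × v ≤ m
∈-oneTo⁻ v∈ with ∈-map⁻ suc v∈
... | i , i∈ , refl = z<s , ∈-upTo⁻ i∈

length-oneTo : ∀ m → length (oneTo m) ≡ m
length-oneTo m = trans (length-map suc (upTo m)) (length-upTo m)

Unique-oneTo : ∀ m → Unique (oneTo m)
Unique-oneTo m = Unique.map⁺ suc-injective (Unique.upTo⁺ m)

record IsPermutationOf (lo m : ℕ) (w : List ℕ) : Set where
  constructor mkPerm
  field
    length≡ : length w ≡ m
    bounded : All (λ x → lo < x × x ≤ lo + m) w
    unique  : Unique w

open IsPermutationOf using (bounded)

IsPermutation : ℕ → List ℕ → Set
IsPermutation = IsPermutationOf 0

Bounded : ℕ → List ℕ → Set
Bounded m = All (λ x → 0 < x × x ≤ m)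

IsPermutation-∈ : ∀ {w} → IsPermutation m w → 0 < v → v ≤ m → v ∈ w
IsPermutation-∈ {m} {v} {w} (mkPerm len bnd u) 0<v v≤m with v ∈? w
... | yes v∈w = v∈w
... | no  v∉w = contradiction (subst₂ _≤_ (cong suc len) (length-oneTo m) (pigeonhole (fresh ∷ u) sub))
                              1+n≰n
  where
  fresh : All (v ≢_) w
  fresh = All.tabulate λ x∈ v≡x → v∉w (subst (_∈ w) (sym v≡x) x∈)
  sub : ∀ {x} → x ∈ v ∷ w → x ∈ oneTo m
  sub (here refl) = ∈-oneTo⁺ 0<v v≤m
  sub (there x∈)  = let 0<x , x≤m = All.lookup bnd x∈ in ∈-oneTo⁺ 0<x x≤m

IsPermutationOf-lo∉ : ∀ {lo w} → IsPermutationOf lo m w → lo ∉ w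
IsPermutationOf-lo∉ p lo∈ = <-irrefl refl (proj₁ (All.lookup (bounded p) lo∈))

complement : ℕ → List ℕ → List ℕ
complement m = map (suc m ∸_)

shift unshift : ℕ → List ℕ → List ℕ
shift   J = map (_+ J)
unshift J = map (_∸ J)

complement-involutive : ∀ {w} → Bounded m w → complement m (complement m w) ≡ w
complement-involutive []              = refl
complement-involutive ((_ , x≤m) ∷ b) = cong₂ _∷_ (m∸[m∸n]≡n (m≤n⇒m≤1+n x≤m)) (complement-involutive b)

shift-unshift : ∀ {J w} → All (J ≤_) w → shift J (unshift J w) ≡ w
shift-unshift []          = refl
shift-unshift (J≤x ∷ J≤w) = cong₂ _∷_ (m∸n+n≡m J≤x) (shift-unshift J≤w)

unshift-shift : ∀ J w → unshift J (shift J w) ≡ w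
unshift-shift J []      = refl
unshift-shift J (x ∷ w) = cong₂ _∷_ (m+n∸n≡m x J) (unshift-shift J w)

IsPermutation-complement : ∀ {w} → IsPermutation m w → IsPermutation m (complement m w)
IsPermutation-complement {m} {w} (mkPerm len bnd u) = mkPerm
  (trans (length-map _ w) len)
  (AllP.map⁺ (All.map (λ (0<x , x≤m) → m<n⇒0<n∸m (s≤s x≤m) , ∸-monoʳ-≤ (suc m) 0<x) bnd))
  (Unique-map⁺-on (λ x∈ y∈ → ∸-cancelˡ-≡ (≤-upper x∈) (≤-upper y∈)) u)
  where
  ≤-upper : ∀ {x} → x ∈ w → x ≤ suc m
  ≤-upper x∈ = m≤n⇒m≤1+n (proj₂ (All.lookup bnd x∈))

IsPermutation-shift : ∀ J {w} → IsPermutation m w → IsPermutationOf J m (shift J w)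
IsPermutation-shift {m} J {w} (mkPerm len bnd u) = mkPerm
  (trans (length-map _ w) len)
  (AllP.map⁺ (All.map (λ {x} (0<x , x≤m) → m<n+m J 0<x , subst (_≤ J + m) (+-comm J x) (+-monoʳ-≤ J x≤m)) bnd))
  (Unique.map⁺ (λ {x} {y} → +-cancelʳ-≡ J x y) u)

IsPermutationOf-unshift : ∀ {J w} → IsPermutationOf J m w → IsPermutation m (unshift J w)
IsPermutationOf-unshift {m} {J} {w} (mkPerm len bnd u) = mkPerm
  (trans (length-map _ w) len)
  (AllP.map⁺ (All.map (λ {x} (J<x , x≤J+m) →
     m<n⇒0<n∸m J<x , subst (x ∸ J ≤_) (m+n∸m≡n J m) (∸-monoˡ-≤ J x≤J+m)) bnd))
  (Unique-map⁺-on (λ x∈ y∈ x∸J≡y∸J → begin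
      _           ≡⟨ m∸n+n≡m (J≤ x∈) ⟨
      _ ∸ J + J   ≡⟨ cong (_+ J) x∸J≡y∸J ⟩
      _ ∸ J + J   ≡⟨ m∸n+n≡m (J≤ y∈) ⟩
      _           ∎) u)
  where
  open ≡-Reasoning
  J≤ : ∀ {x} → x ∈ w → J ≤ x
  J≤ x∈ = <⇒≤ (proj₁ (All.lookup bnd x∈))

IsPermutation-glue : ∀ {a b xs ys} → IsPermutationOf 2 a xs → IsPermutationOf (2 + a) b ys →
                     IsPermutation (2 + a + b) (xs ++ 2 ∷ 1 ∷ ys)
IsPermutation-glue {a} {b} {xs} {ys} (mkPerm lenX bndX uX) (mkPerm lenY bndY uY) = mkPerm
  (begin
    length (xs ++ 2 ∷ 1 ∷ ys)   ≡⟨ length-++ xs ⟩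
    length xs + (2 + length ys) ≡⟨ cong₂ (λ m n → m + (2 + n)) lenX lenY ⟩
    a + (2 + b)                 ≡⟨ +-suc a (suc b) ⟩
    suc (a + suc b)             ≡⟨ cong suc (+-suc a b) ⟩
    2 + a + b                   ∎)
  (AllP.++⁺ (All.map (λ (2<x , x≤) → <-trans z<s 2<x , ≤-trans x≤ (m≤m+n (2 + a) b)) bndX)
            ((z<s , s≤s (s≤s z≤n)) ∷ (z<s , s≤s z≤n) ∷ All.map (λ (lt , y≤) → <-trans z<s lt , y≤) bndY))
  (Unique.++⁺ uX
     (((λ ()) ∷ All.map (λ (lt , _) → <⇒≢ (≤-<-trans (m≤m+n 2 a) lt)) bndY)
      ∷ All.map (λ (lt , _) → <⇒≢ (≤-<-trans (m≤m+n 1 (suc a)) lt)) bndY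
      ∷ uY)
     (λ (x∈ , x∈′) → apart (All.lookup bndX x∈) x∈′))
  where
  open ≡-Reasoning
  apart : ∀ {x} → 2 < x × x ≤ 2 + a → x ∉ 2 ∷ 1 ∷ ys
  apart (2<x , _)  (here refl)         = <-irrefl refl 2<x
  apart (2<x , _)  (there (here refl)) = contradiction 2<x λ { (s≤s ()) }
  apart (_   , x≤) (there (there x∈))  = <⇒≱ (proj₁ (All.lookup bndY x∈)) x≤

-- A letter of xs above length xs would force all of 1, …, length xs + 1 into xs.
IsPermutation-++-separated : ∀ {xs ys} → IsPermutation m (xs ++ ys) →
                             (∀ {x y} → x ∈ xs → y ∈ ys → x < y) →
                             All (_≤ length xs) xs × All (length xs <_) ys
IsPermutation-++-separated {m} {xs} {ys} p@(mkPerm _ bnd u) xs<ys = xs≤ , All.tabulate ys>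
  where
  a : ℕ
  a = length xs
  xs≤ : All (_≤ a) xs
  xs≤ = All.tabulate λ {x} x∈ → case x ≤? a of λ
    { (yes x≤a) → x≤a
    ; (no  x≰a) → contradiction (pigeonhole (Unique-oneTo (suc a)) (below x∈ (≰⇒> x≰a)))
                                (subst (_≰ a) (sym (length-oneTo (suc a))) 1+n≰n) }
    where
    below : ∀ {x} → x ∈ xs → a < x → ∀ {v} → v ∈ oneTo (suc a) → v ∈ xs
    below {x} x∈ a<x {v} v∈ = [ id , (λ v∈ys → contradiction v≤x (<⇒≱ (xs<ys x∈ v∈ys))) ]′ (∈-++⁻ xs v∈xs++ys)
      where
      v≤x : v ≤ x
      v≤x = ≤-trans (proj₂ (∈-oneTo⁻ v∈)) a<x
      v∈xs++ys : v ∈ xs ++ ys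
      v∈xs++ys = IsPermutation-∈ p (proj₁ (∈-oneTo⁻ v∈)) (≤-trans v≤x (proj₂ (All.lookup bnd (∈-++⁺ˡ x∈))))
  ys> : ∀ {y} → y ∈ ys → a < y
  ys> {y} y∈ with a <? y
  ... | yes a<y = a<y
  ... | no  a≮y = contradiction y∈ (Unique-++⁻-disjoint xs u y∈xs)
    where
    lower : IsPermutation a xs
    lower = mkPerm refl (All.zipWith (λ ((0<x , _) , x≤a) → 0<x , x≤a) (AllP.++⁻ˡ xs bnd , xs≤))
                   (Unique-++⁻ˡ xs u)
    y∈xs : y ∈ xs
    y∈xs = IsPermutation-∈ lower (proj₁ (All.lookup bnd (∈-++⁺ʳ xs y∈))) (≮⇒≥ a≮y)

-- Dumont words

data Step (x y : ℕ) : Set where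
  descent : evenᵇ x ≡ true  → y < x → Step x y
  ascent  : evenᵇ x ≡ false → x < y → Step x y

-- Dumont false is the paper's condition; Dumont true describes a prefix that
-- is followed by a smaller letter.
Dumont : Bool → List ℕ → Set
Dumont b []          = ⊤
Dumont b (x ∷ [])    = evenᵇ x ≡ b
Dumont b (x ∷ y ∷ w) = Step x y × Dumont b (y ∷ w)

Step-complement : ∀ {M x y} → evenᵇ M ≡ false → x ≤ M → y ≤ M → Step x y → Step (M ∸ x) (M ∸ y)
Step-complement {x = x} M-odd x≤M y≤M (descent e y<x) =
  ascent (trans (evenᵇ-∸-odd x M-odd x≤M) (cong not e)) (∸-monoʳ-< y<x x≤M)
Step-complement {x = x} M-odd x≤M y≤M (ascent e x<y) =
  descent (trans (evenᵇ-∸-odd x M-odd x≤M) (cong not e)) (∸-monoʳ-< x<y y≤M)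

Dumont-complement : ∀ {M b w} → evenᵇ M ≡ false → All (_≤ M) w → Dumont b w →
                    Dumont (not b) (map (M ∸_) w)
Dumont-complement {w = []}        _     _                 _          = _
Dumont-complement {w = x ∷ []}    M-odd (x≤M ∷ _)         e          =
  trans (evenᵇ-∸-odd x M-odd x≤M) (cong not e)
Dumont-complement {w = x ∷ y ∷ w} M-odd (x≤M ∷ y≤M ∷ w≤M) (step , d) =
  Step-complement M-odd x≤M y≤M step , Dumont-complement M-odd (y≤M ∷ w≤M) d

Step-shift⇔ : ∀ {J x y} → evenᵇ J ≡ true → Step (x + J) (y + J) ⇔ Step x y
Step-shift⇔ {J} {x} J-even = mk⇔
  (λ { (descent e lt) → descent (trans (sym (evenᵇ-+-even x J-even)) e) (+-cancelʳ-< J _ _ lt)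
     ; (ascent e lt)  → ascent (trans (sym (evenᵇ-+-even x J-even)) e) (+-cancelʳ-< J _ _ lt) })
  (λ { (descent e lt) → descent (trans (evenᵇ-+-even x J-even) e) (+-monoˡ-< J lt)
     ; (ascent e lt)  → ascent (trans (evenᵇ-+-even x J-even) e) (+-monoˡ-< J lt) })

Dumont-shift⇔ : ∀ {J b} → evenᵇ J ≡ true → ∀ w → Dumont b (shift J w) ⇔ Dumont b w
Dumont-shift⇔ J-even []          = ⇔.refl
Dumont-shift⇔ J-even (x ∷ [])    = subst-⇔ (_≡ _) (evenᵇ-+-even x J-even)
Dumont-shift⇔ J-even (x ∷ y ∷ w) = Step-shift⇔ J-even ×-⇔ Dumont-shift⇔ J-even (y ∷ w)

Dumont-tail : ∀ {b x} w → Dumont b (x ∷ w) → Dumont b w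
Dumont-tail []      _       = _
Dumont-tail (y ∷ w) (_ , d) = d

Dumont-++⁻ʳ : ∀ {b} xs {ys} → Dumont b (xs ++ ys) → Dumont b ys
Dumont-++⁻ʳ []       d = d
Dumont-++⁻ʳ (x ∷ xs) d = Dumont-++⁻ʳ xs (Dumont-tail (xs ++ _) d)

Dumont-++ : ∀ {b y} xs {ys} → All (y <_) xs → Dumont true xs → Dumont b (y ∷ ys) → Dumont b (xs ++ y ∷ ys)
Dumont-++ []           _              _          d = d
Dumont-++ (x ∷ [])     (y<x ∷ _)      e          d = descent e y<x , d
Dumont-++ (x ∷ x′ ∷ xs) (_ ∷ y<xs)    (step , e) d = step , Dumont-++ (x′ ∷ xs) y<xs e d

Dumont-++⁻ˡ : ∀ {b y} xs {ys} → All (y <_) xs → Dumont b (xs ++ y ∷ ys) → Dumont true xs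
Dumont-++⁻ˡ []            _         _                   = _
Dumont-++⁻ˡ (x ∷ [])      _         (descent e _ , _)   = e
Dumont-++⁻ˡ (x ∷ [])      (y<x ∷ _) (ascent _ x<y , _)  = contradiction x<y (<-asym y<x)
Dumont-++⁻ˡ (x ∷ x′ ∷ xs) (_ ∷ y<xs) (step , d)         = step , Dumont-++⁻ˡ (x′ ∷ xs) y<xs d

Dumont-∷-ascent : ∀ {x w} → evenᵇ x ≡ false → All (x <_) w → Dumont false w → Dumont false (x ∷ w)
Dumont-∷-ascent {w = []}    x-odd _         _ = x-odd
Dumont-∷-ascent {w = y ∷ w} x-odd (x<y ∷ _) d = ascent x-odd x<y , d

Dumont-even-descent : ∀ {x} w → Dumont false (x ∷ w) → evenᵇ x ≡ true → ∃ λ z → ∃ λ zs → w ≡ z ∷ zs × z < x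
Dumont-even-descent []      x-odd               x-even = contradiction (trans (sym x-even) x-odd) λ ()
Dumont-even-descent (z ∷ w) (descent _ z<x , _) _      = z , w , refl , z<x
Dumont-even-descent (z ∷ w) (ascent x-odd _ , _) x-even = contradiction (trans (sym x-even) x-odd) λ ()

Dumont-2∷1 : ∀ {N w} → 2 ≤ N → IsPermutation N w → Dumont false w → ∃ λ L → ∃ λ R → w ≡ L ++ 2 ∷ 1 ∷ R
Dumont-2∷1 2≤N p@(mkPerm _ bnd _) d with ∈-∃++ (IsPermutation-∈ p z<s 2≤N)
... | L , rest , refl with Dumont-even-descent rest (Dumont-++⁻ʳ L d) refl
...   | z , R , refl , z<2 with ≤-antisym (s≤s⁻¹ z<2) (proj₁ (All.lookup bnd (∈-++⁺ʳ L (there (here refl)))))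
...     | refl = L , R , refl

-- Were length xs odd, the even letter length xs + 1 of ys would be followed by a smaller letter of ys.
Dumont-lowerBlock-even : ∀ {N xs ys} → evenᵇ N ≡ true → IsPermutation N (xs ++ ys) → Dumont false (xs ++ ys) →
                         All (_≤ length xs) xs → All (length xs <_) ys → evenᵇ (length xs) ≡ true
Dumont-lowerBlock-even {N} {xs} {ys} N-even p d xs≤ ys> = ¬-not notOdd
  where
  j : ℕ
  j = length xs
  j<N : evenᵇ j ≡ false → j < N
  j<N j-odd = ≤∧≢⇒< (subst (j ≤_) (IsPermutationOf.length≡ p) (length-++-≤ˡ xs))
                    (λ j≡N → contradiction (trans (sym j-odd) (trans (cong evenᵇ j≡N) N-even)) λ ())
  notOdd : evenᵇ j ≢ false
  notOdd j-odd with ∈-++⁻ xs (IsPermutation-∈ p z<s (j<N j-odd))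
  ... | inj₁ 1+j∈xs = contradiction (All.lookup xs≤ 1+j∈xs) 1+n≰n
  ... | inj₂ 1+j∈ys with ∈-∃++ 1+j∈ys
  ...   | ys₁ , ys₂ , refl with Dumont-even-descent ys₂ (Dumont-++⁻ʳ ys₁ (Dumont-++⁻ʳ xs d))
                                                (trans (evenᵇ-suc j) (cong not j-odd))
  ...     | z , _ , refl , z<1+j =
    contradiction (All.lookup ys> (∈-++⁺ʳ ys₁ (there (here refl)))) (≤⇒≯ (s≤s⁻¹ z<1+j))

-- Pattern occurrences

Pattern4213 Pattern1342 : ℕ → ℕ → ℕ → ℕ → Set
Pattern4213 a b c d = c < b × b < d × d < a
Pattern1342 a b c d = a < d × d < b × b < c

Occurs : (ℕ → ℕ → ℕ → ℕ → Set) → List ℕ → Set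
Occurs P w = ∃ λ a → ∃ λ b → ∃ λ c → ∃ λ d → a ∷ b ∷ c ∷ d ∷ [] ⊆ w × P a b c d

Occurs-⊆ : ∀ {P w w′} → w ⊆ w′ → Occurs P w → Occurs P w′
Occurs-⊆ w⊆ (a , b , c , d , s⊆ , pat) = a , b , c , d , ⊆-trans s⊆ w⊆ , pat

Occurs-map⁻ : ∀ {P Q} (f : ℕ → ℕ) → (∀ {a b c d} → P (f a) (f b) (f c) (f d) → Q a b c d) →
              ∀ {w} → Occurs P (map f w) → Occurs Q w
Occurs-map⁻ f P⇒Q (_ , _ , _ , _ , s⊆ , pat) with ⊆-map⁻ f s⊆
... | a ∷ b ∷ c ∷ d ∷ [] , s′⊆ , refl ∷ refl ∷ refl ∷ refl ∷ [] = a , b , c , d , s′⊆ , P⇒Q pat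

Occurs4213-shift⁻ : ∀ J {w} → Occurs Pattern4213 (shift J w) → Occurs Pattern4213 w
Occurs4213-shift⁻ J = Occurs-map⁻ (_+ J) λ (p , q , r) → cancel p , cancel q , cancel r
  where
  cancel : ∀ {x y} → x + J < y + J → x < y
  cancel = +-cancelʳ-< J _ _

Occurs4213-unshift⁻ : ∀ J {w} → Occurs Pattern4213 (unshift J w) → Occurs Pattern4213 w
Occurs4213-unshift⁻ J = Occurs-map⁻ (_∸ J) λ (p , q , r) → cancel p , cancel q , cancel r
  where
  cancel : ∀ {x y} → x ∸ J < y ∸ J → x < y
  cancel lt = ≰⇒> (<⇒≱ lt ∘ ∸-monoˡ-≤ J)

Occurs4213-complement⁻ : ∀ m {w} → Occurs Pattern4213 (complement m w) → Occurs Pattern1342 w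
Occurs4213-complement⁻ m = Occurs-map⁻ (suc m ∸_) λ (p , q , r) → ∸-cancelʳ-< r , ∸-cancelʳ-< q , ∸-cancelʳ-< p

Occurs1342-complement⁻ : ∀ m {w} → Occurs Pattern1342 (complement m w) → Occurs Pattern4213 w
Occurs1342-complement⁻ m = Occurs-map⁻ (suc m ∸_) λ (p , q , r) → ∸-cancelʳ-< r , ∸-cancelʳ-< q , ∸-cancelʳ-< p

Occurs4213-++ : ∀ xs {ys} → (∀ {x y} → x ∈ xs → y ∈ ys → x < y) →
                Occurs Pattern4213 (xs ++ ys) → Occurs Pattern4213 xs ⊎ Occurs Pattern4213 ys
Occurs4213-++ xs {ys} xs<ys (a , b , c , d , s⊆ , pat@(_ , _ , d<a)) = split (⊆-++⁻ xs s⊆)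
  where
  straddles : ∀ {s₁ s₂} → a ∷ s₁ ⊆ xs → s₂ ⊆ ys → d ∈ s₂ → ⊥
  straddles s₁⊆ s₂⊆ d∈ = <-asym d<a (xs<ys (⊆-lookup s₁⊆ (here refl)) (⊆-lookup s₂⊆ d∈))
  split : (∃ λ s₁ → ∃ λ s₂ → a ∷ b ∷ c ∷ d ∷ [] ≡ s₁ ++ s₂ × s₁ ⊆ xs × s₂ ⊆ ys) →
          Occurs Pattern4213 xs ⊎ Occurs Pattern4213 ys
  split ([]                 , _  , refl , _   , s₂⊆) = inj₂ (a , b , c , d , s₂⊆ , pat)
  split (_ ∷ _ ∷ _ ∷ _ ∷ [] , [] , refl , s₁⊆ , _  ) = inj₁ (a , b , c , d , s₁⊆ , pat)
  split (_ ∷ []             , _  , refl , s₁⊆ , s₂⊆) = ⊥-elim (straddles s₁⊆ s₂⊆ (there (there (here refl))))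
  split (_ ∷ _ ∷ []         , _  , refl , s₁⊆ , s₂⊆) = ⊥-elim (straddles s₁⊆ s₂⊆ (there (here refl)))
  split (_ ∷ _ ∷ _ ∷ []     , _  , refl , s₁⊆ , s₂⊆) = ⊥-elim (straddles s₁⊆ s₂⊆ (here refl))

Occurs4213-++-small : ∀ xs {ys} → All (0 <_) (xs ++ ys) → All (_≤ 2) ys →
                      Occurs Pattern4213 (xs ++ ys) → Occurs Pattern4213 xs
Occurs4213-++-small xs {ys} pos small (a , b , c , d , s⊆ , pat@(c<b , b<d , _)) = split (⊆-++⁻ xs s⊆)
  where
  tooSmall : ∀ {s₂} → s₂ ⊆ ys → d ∈ s₂ → ⊥
  tooSmall s₂⊆ d∈ = <⇒≱ (≤-<-trans (≤-<-trans 0<c c<b) b<d) (All.lookup small (⊆-lookup s₂⊆ d∈))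
    where
    0<c : 0 < c
    0<c = All.lookup pos (⊆-lookup s⊆ (there (there (here refl))))
  split : (∃ λ s₁ → ∃ λ s₂ → a ∷ b ∷ c ∷ d ∷ [] ≡ s₁ ++ s₂ × s₁ ⊆ xs × s₂ ⊆ ys) → Occurs Pattern4213 xs
  split (_ ∷ _ ∷ _ ∷ _ ∷ [] , [] , refl , s₁⊆ , _) = a , b , c , d , s₁⊆ , pat
  split ([]             , _ , refl , _ , s₂⊆) = ⊥-elim (tooSmall s₂⊆ (there (there (there (here refl)))))
  split (_ ∷ []         , _ , refl , _ , s₂⊆) = ⊥-elim (tooSmall s₂⊆ (there (there (here refl))))
  split (_ ∷ _ ∷ []     , _ , refl , _ , s₂⊆) = ⊥-elim (tooSmall s₂⊆ (there (here refl)))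
  split (_ ∷ _ ∷ _ ∷ [] , _ , refl , _ , s₂⊆) = ⊥-elim (tooSmall s₂⊆ (here refl))

record 𝔇¹ (P : ℕ → ℕ → ℕ → ℕ → Set) (n : ℕ) (w : List ℕ) : Set where
  constructor mk𝔇¹
  field
    perm     : IsPermutation (2 * n) w
    dumont   : Dumont false w
    avoiding : ¬ Occurs P w

-- The decomposition

above2 : ∀ {x} → 0 < x → x ≢ 1 → x ≢ 2 → 2 < x
above2 {1}                 _ x≢1 _   = contradiction refl x≢1
above2 {2}                 _ _   x≢2 = contradiction refl x≢2
above2 {suc (suc (suc _))} _ _   _   = s≤s (s≤s (s≤s z≤n))

-- x ∈ L and y ∈ R with y < x would make x 2 1 y an occurrence of 4213.
Avoiding4213-blocks : ∀ {N} L R → IsPermutation N (L ++ 2 ∷ 1 ∷ R) → ¬ Occurs Pattern4213 (L ++ 2 ∷ 1 ∷ R) →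
                      All (2 <_) L × All (2 <_) R × (∀ {x y} → x ∈ L → y ∈ R → x < y)
Avoiding4213-blocks L R (mkPerm _ bnd u) avoid = L>2 , R>2 , L<R
  where
  pos : ∀ {x} → x ∈ L ++ 2 ∷ 1 ∷ R → 0 < x
  pos = proj₁ ∘ All.lookup bnd
  L>2 : All (2 <_) L
  L>2 = All.tabulate λ x∈ → above2 (pos (∈-++⁺ˡ x∈)) (Unique-++⁻-disjoint L u x∈ ∘ there ∘ here)
                                                     (Unique-++⁻-disjoint L u x∈ ∘ here)
  R>2 : All (2 <_) R
  R>2 with Unique-++⁻ʳ L u
  ... | (_ ∷ 2∉R) ∷ 1∉R ∷ _ = All.tabulate λ y∈ →
    above2 (pos (∈-++⁺ʳ L (there (there y∈)))) (All.lookup 1∉R y∈ ∘ sym) (All.lookup 2∉R y∈ ∘ sym)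
  L<R : ∀ {x y} → x ∈ L → y ∈ R → x < y
  L<R {x} {y} x∈ y∈ with <-cmp x y
  ... | tri< x<y _ _  = x<y
  ... | tri≈ _ refl _ = contradiction (there (there y∈)) (Unique-++⁻-disjoint L u x∈)
  ... | tri> _ _ y<x  = contradiction
    (x , 2 , 1 , y , ⊆.++⁺ (from∈ x∈) (refl ∷ refl ∷ from∈ y∈) , s≤s (s≤s z≤n) , All.lookup R>2 y∈ , y<x) avoid

size-assembled : ∀ {k n} → k ≤ n → 2 + 2 * k + 2 * (n ∸ k) ≡ 2 * suc n
size-assembled {k} {n} k≤n = begin
  2 + (2 * k + 2 * (n ∸ k)) ≡⟨ cong (2 +_) (*-distribˡ-+ 2 k (n ∸ k)) ⟨
  2 + 2 * (k + (n ∸ k))     ≡⟨ cong (λ m → 2 + 2 * m) (m+[n∸m]≡n k≤n) ⟩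
  2 + 2 * n                 ≡⟨ *-suc 2 n ⟨
  2 * suc n                 ∎
  where open ≡-Reasoning

assemble : ℕ → List ℕ → List ℕ → List ℕ
assemble k β τ = shift 2 (complement (2 * k) β) ++ 2 ∷ 1 ∷ shift (2 + 2 * k) τ

assemble-𝔇¹ : ∀ {n k β τ} → k ≤ n → 𝔇¹ Pattern1342 k β → 𝔇¹ Pattern4213 (n ∸ k) τ →
              𝔇¹ Pattern4213 (suc n) (assemble k β τ)
assemble-𝔇¹ {n} {k} {β} {τ} k≤n (mk𝔇¹ pβ dβ avβ) (mk𝔇¹ pτ dτ avτ) =
  mk𝔇¹ (subst (λ N → IsPermutation N (X ++ 2 ∷ 1 ∷ Y)) (size-assembled k≤n) (IsPermutation-glue pX pY))
       (Dumont-++ X (All.map proj₁ (bounded pX)) dX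
                  (descent refl (s≤s (s≤s z≤n)) , Dumont-∷-ascent refl 1<Y dY))
       avoid
  where
  X Y : List ℕ
  X = shift 2 (complement (2 * k) β)
  Y = shift (2 + 2 * k) τ
  pX : IsPermutationOf 2 (2 * k) X
  pX = IsPermutation-shift 2 (IsPermutation-complement pβ)
  pY : IsPermutationOf (2 + 2 * k) (2 * (n ∸ k)) Y
  pY = IsPermutation-shift (2 + 2 * k) pτ
  dX : Dumont true X
  dX = Equivalence.from (Dumont-shift⇔ refl (complement (2 * k) β))
         (Dumont-complement (evenᵇ-1+2* k) (All.map (m≤n⇒m≤1+n ∘ proj₂) (bounded pβ)) dβ)
  dY : Dumont false Y
  dY = Equivalence.from (Dumont-shift⇔ (evenᵇ-2* k) τ) dτ
  1<Y : All (1 <_) Y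
  1<Y = All.map (λ (lt , _) → ≤-<-trans (s≤s z≤n) lt) (bounded pY)
  lower<Y : ∀ {x y} → x ∈ X ++ 2 ∷ 1 ∷ [] → y ∈ Y → x < y
  lower<Y x∈ y∈ = ≤-<-trans (x≤ (∈-++⁻ X x∈)) (proj₁ (All.lookup (bounded pY) y∈))
    where
    x≤ : ∀ {x} → x ∈ X ⊎ x ∈ 2 ∷ 1 ∷ [] → x ≤ 2 + 2 * k
    x≤ (inj₁ x∈X)                  = proj₂ (All.lookup (bounded pX) x∈X)
    x≤ (inj₂ (here refl))          = m≤m+n 2 (2 * k)
    x≤ (inj₂ (there (here refl)))  = s≤s z≤n
  avoid : ¬ Occurs Pattern4213 (X ++ 2 ∷ 1 ∷ Y)
  avoid occ
    with Occurs4213-++ (X ++ 2 ∷ 1 ∷ []) lower<Y (subst (Occurs Pattern4213) (sym (++-assoc X _ Y)) occ)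
  ... | inj₁ occ′ = avβ (Occurs4213-complement⁻ (2 * k) (Occurs4213-shift⁻ 2 (Occurs4213-++-small X
                      (AllP.++⁺ (All.map (λ (lt , _) → <-trans z<s lt) (bounded pX)) (z<s ∷ z<s ∷ []))
                      (s≤s (s≤s z≤n) ∷ s≤s z≤n ∷ []) occ′)))
  ... | inj₂ occY = avτ (Occurs4213-shift⁻ (2 + 2 * k) occY)

Assembled : ℕ → List ℕ → Set
Assembled n w = ∃ λ k → k ≤ n × ∃ λ β → ∃ λ τ →
  𝔇¹ Pattern1342 k β × 𝔇¹ Pattern4213 (n ∸ k) τ × w ≡ assemble k β τ

unassemble : ∀ {n k L R} → k ≤ n →
             IsPermutationOf 2 (2 * k) L → Dumont true L → ¬ Occurs Pattern4213 L →
             IsPermutationOf (2 + 2 * k) (2 * (n ∸ k)) R → Dumont false R → ¬ Occurs Pattern4213 R →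
             Assembled n (L ++ 2 ∷ 1 ∷ R)
unassemble {n} {k} {L} {R} k≤n pL dL avL pR dR avR =
  k , k≤n , β , τ , mk𝔇¹ pβ dβ (avL ∘ Occurs4213-unshift⁻ 2 ∘ Occurs1342-complement⁻ (2 * k)) ,
  mk𝔇¹ (IsPermutationOf-unshift pR) dτ (avR ∘ Occurs4213-unshift⁻ (2 + 2 * k)) ,
  cong₂ (λ X Y → X ++ 2 ∷ 1 ∷ Y) L≡ (sym R≡)
  where
  L′ β τ : List ℕ
  L′ = unshift 2 L
  β = complement (2 * k) L′
  τ = unshift (2 + 2 * k) R
  pL′ : IsPermutation (2 * k) L′
  pL′ = IsPermutationOf-unshift pL
  pβ : IsPermutation (2 * k) β
  pβ = IsPermutation-complement pL′
  L′≡ : shift 2 L′ ≡ L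
  L′≡ = shift-unshift (All.map (<⇒≤ ∘ proj₁) (bounded pL))
  L≡ : L ≡ shift 2 (complement (2 * k) β)
  L≡ = sym (trans (cong (shift 2) (complement-involutive (bounded pL′))) L′≡)
  R≡ : shift (2 + 2 * k) τ ≡ R
  R≡ = shift-unshift (All.map (<⇒≤ ∘ proj₁) (bounded pR))
  dβ : Dumont false β
  dβ = Dumont-complement (evenᵇ-1+2* k) (All.map (m≤n⇒m≤1+n ∘ proj₂) (bounded pL′))
         (Equivalence.to (Dumont-shift⇔ refl L′) (subst (Dumont true) (sym L′≡) dL))
  dτ : Dumont false τ
  dτ = Equivalence.to (Dumont-shift⇔ (evenᵇ-2* k) τ) (subst (Dumont false) (sym R≡) dR)

IsPermutation-2∷1-blocks : ∀ {N} L R → IsPermutation N (L ++ 2 ∷ 1 ∷ R) →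
                           All (2 <_) L → All (2 <_) R → (∀ {x y} → x ∈ L → y ∈ R → x < y) →
                           IsPermutationOf 2 (length L) L × IsPermutationOf (2 + length L) (N ∸ (2 + length L)) R
IsPermutation-2∷1-blocks {N} L R p L>2 R>2 L<R =
  mkPerm refl
    (All.zipWith (λ (2<x , x≤) → 2<x , subst (_ ≤_) |Lp| x≤) (L>2 , AllP.++⁻ˡ L (proj₁ separated)))
    (Unique-++⁻ˡ L (IsPermutationOf.unique p)) ,
  mkPerm |R|
    (All.zipWith (λ {y} (j<y , (_ , y≤N)) → subst (_< y) |Lp| j<y , subst (y ≤_) (sym (m+[n∸m]≡n |Lp|≤N)) y≤N)
                 (proj₂ separated , AllP.++⁻ʳ Lp (bounded p′)))
    (Unique-++⁻ʳ Lp (IsPermutationOf.unique p′))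
  where
  Lp : List ℕ
  Lp = L ++ 2 ∷ 1 ∷ []
  p′ : IsPermutation N (Lp ++ R)
  p′ = subst (IsPermutation N) (sym (++-assoc L (2 ∷ 1 ∷ []) R)) p
  lower<R : ∀ {x y} → x ∈ Lp → y ∈ R → x < y
  lower<R x∈ y∈ with ∈-++⁻ L x∈
  ... | inj₁ x∈L                 = L<R x∈L y∈
  ... | inj₂ (here refl)         = All.lookup R>2 y∈
  ... | inj₂ (there (here refl)) = <-trans (s≤s (s≤s z≤n)) (All.lookup R>2 y∈)
  separated : All (_≤ length Lp) Lp × All (length Lp <_) R
  separated = IsPermutation-++-separated p′ lower<R
  |Lp| : length Lp ≡ 2 + length L
  |Lp| = trans (length-++ L) (+-comm (length L) 2)
  |Lp+R| : length Lp + length R ≡ N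
  |Lp+R| = trans (sym (length-++ Lp)) (IsPermutationOf.length≡ p′)
  |Lp|≤N : 2 + length L ≤ N
  |Lp|≤N = subst₂ _≤_ |Lp| |Lp+R| (m≤m+n (length Lp) (length R))
  |R| : length R ≡ N ∸ (2 + length L)
  |R| = trans (sym (m+n∸m≡n (length Lp) (length R))) (cong₂ _∸_ |Lp+R| |Lp|)

Dumont-2∷1-even : ∀ {n m} L R → IsPermutation (2 * suc n) (L ++ 2 ∷ 1 ∷ R) → Dumont false (L ++ 2 ∷ 1 ∷ R) →
                  IsPermutationOf 2 (length L) L → IsPermutationOf (2 + length L) m R → evenᵇ (length L) ≡ true
Dumont-2∷1-even {n} L R p d pL pR =
  trans (sym (evenᵇ-+-even (length L) refl)) (subst (λ j → evenᵇ j ≡ true) |Lp| Lp-even)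
  where
  Lp : List ℕ
  Lp = L ++ 2 ∷ 1 ∷ []
  assoc : L ++ 2 ∷ 1 ∷ R ≡ Lp ++ R
  assoc = sym (++-assoc L (2 ∷ 1 ∷ []) R)
  |Lp| : length Lp ≡ length L + 2
  |Lp| = length-++ L
  |Lp|′ : length Lp ≡ 2 + length L
  |Lp|′ = trans |Lp| (+-comm (length L) 2)
  2≤ : 2 ≤ length Lp
  2≤ = subst (2 ≤_) (sym |Lp|) (m≤n+m 2 (length L))
  Lp≤ : All (_≤ length Lp) Lp
  Lp≤ = AllP.++⁺ (All.map (λ (_ , x≤) → subst (_ ≤_) (sym |Lp|′) x≤) (bounded pL)) (2≤ ∷ ≤-trans (n≤1+n 1) 2≤ ∷ [])
  R> : All (length Lp <_) R
  R> = All.map (λ {y} (j<y , _) → subst (_< y) (sym |Lp|′) j<y) (bounded pR)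
  Lp-even : evenᵇ (length Lp) ≡ true
  Lp-even = Dumont-lowerBlock-even (evenᵇ-2* (suc n)) (subst (IsPermutation _) assoc p)
                                   (subst (Dumont false) assoc d) Lp≤ R>

disassemble-2∷1 : ∀ {n} L R → IsPermutation (2 * suc n) (L ++ 2 ∷ 1 ∷ R) → Dumont false (L ++ 2 ∷ 1 ∷ R) →
                  ¬ Occurs Pattern4213 (L ++ 2 ∷ 1 ∷ R) → Assembled n (L ++ 2 ∷ 1 ∷ R)
disassemble-2∷1 {n} L R p d avoid with Avoiding4213-blocks L R p avoid
... | L>2 , R>2 , L<R with IsPermutation-2∷1-blocks L R p L>2 R>2 L<R
...   | pL , pR with evenᵇ⇒2* (length L) (Dumont-2∷1-even L R p d pL pR)
...     | k , |L|≡2k =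
  unassemble k≤n (subst (λ m → IsPermutationOf 2 m L) |L|≡2k pL) (Dumont-++⁻ˡ L L>2 d)
             (avoid ∘ Occurs-⊆ (⊆.++⁺ʳ (2 ∷ 1 ∷ R) ⊆-refl))
             (subst₂ (λ lo m → IsPermutationOf lo m R) (cong (2 +_) |L|≡2k) |R| pR)
             (Dumont-++⁻ʳ (2 ∷ 1 ∷ []) (Dumont-++⁻ʳ L d))
             (avoid ∘ Occurs-⊆ (⊆.++⁺ˡ L (2 ∷ʳ 1 ∷ʳ ⊆-refl)))
  where
  2+2k≤N : 2 + 2 * k ≤ 2 * suc n
  2+2k≤N = subst₂ _≤_ (trans (+-comm (length L) 2) (cong (2 +_) |L|≡2k))
                      (trans (sym (length-++ L)) (IsPermutationOf.length≡ p))
                      (+-monoʳ-≤ (length L) (m≤m+n 2 (length R)))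
  k≤n : k ≤ n
  k≤n = s≤s⁻¹ (*-cancelˡ-≤ 2 (subst (_≤ 2 * suc n) (sym (*-suc 2 k)) 2+2k≤N))
  |R| : 2 * suc n ∸ (2 + length L) ≡ 2 * (n ∸ k)
  |R| = begin
    2 * suc n ∸ (2 + length L) ≡⟨ cong₂ (λ N l → N ∸ (2 + l)) (*-suc 2 n) |L|≡2k ⟩
    2 * n ∸ 2 * k              ≡⟨ *-distribˡ-∸ 2 n k ⟨
    2 * (n ∸ k)                ∎
    where open ≡-Reasoning

disassemble : ∀ {n w} → 𝔇¹ Pattern4213 (suc n) w → Assembled n w
disassemble {n} (mk𝔇¹ p d avoid) with Dumont-2∷1 (*-monoʳ-≤ 2 (s≤s z≤n)) p d
... | L , R , refl = disassemble-2∷1 L R p d avoid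

assemble-injective : ∀ {k k′ β β′ τ τ′} → IsPermutation (2 * k) β → IsPermutation (2 * k′) β′ →
                     assemble k β τ ≡ assemble k′ β′ τ′ → k ≡ k′ × β ≡ β′ × τ ≡ τ′
assemble-injective {k} {k′} {β} {β′} {τ} {τ′} pβ pβ′ eq
  with pX ← IsPermutation-shift 2 (IsPermutation-complement pβ)
     | pX′ ← IsPermutation-shift 2 (IsPermutation-complement pβ′)
  with ++-∷-injective _ _ (IsPermutationOf-lo∉ pX) (IsPermutationOf-lo∉ pX′) eq
... | X≡ , 1∷Y≡ with *-cancelˡ-≡ k k′ 2 (trans (sym (IsPermutationOf.length≡ pX))
                                         (trans (cong length X≡) (IsPermutationOf.length≡ pX′)))
...   | refl = refl
             , trans (sym (recover pβ)) (trans (cong (complement (2 * k) ∘ unshift 2) X≡) (recover pβ′))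
             , trans (sym (unshift-shift J τ))
                     (trans (cong (unshift J) (∷-injectiveʳ 1∷Y≡)) (unshift-shift J τ′))
  where
  J : ℕ
  J = 2 + 2 * k
  recover : ∀ {β} → IsPermutation (2 * k) β →
            complement (2 * k) (unshift 2 (shift 2 (complement (2 * k) β))) ≡ β
  recover p = trans (cong (complement (2 * k)) (unshift-shift 2 _)) (complement-involutive (bounded p))

-- Decoding the boolean definitions

∈-words⁻ : ∀ {w} m k → w ∈ words m k → length w ≡ k × Bounded m w
∈-words⁻ m zero    (here refl) = refl , []
∈-words⁻ m (suc k) w∈ with find (∈-concatMap⁻ (λ v → map (v ∷_) (words m k)) {xs = oneTo m} w∈)
... | v , v∈ , w∈vw with ∈-map⁻ (v ∷_) w∈vw
...   | w′ , w′∈ , refl = let len , bnd = ∈-words⁻ m k w′∈ in cong suc len , ∈-oneTo⁻ v∈ ∷ bnd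

∈-words⁺ : ∀ {w} m → Bounded m w → w ∈ words m (length w)
∈-words⁺ {[]}    m []                 = here refl
∈-words⁺ {v ∷ w} m ((0<v , v≤m) ∷ bnd) =
  ∈-concatMap⁺ (λ v → map (v ∷_) (words m (length w)))
    (lose (∈-oneTo⁺ 0<v v≤m) (∈-map⁺ (v ∷_) (∈-words⁺ m bnd)))

words-unique : ∀ m k → Unique (words m k)
words-unique m zero    = [] ∷ []
words-unique m (suc k) =
  Unique-concatMap⁺ (Unique-oneTo m) (λ _ → Unique.map⁺ ∷-injectiveʳ (words-unique m k)) sameHead
  where
  sameHead : ∀ {v v′ w} → v ∈ oneTo m → v′ ∈ oneTo m →
             w ∈ map (v ∷_) (words m k) → w ∈ map (v′ ∷_) (words m k) → v ≡ v′
  sameHead _ _ w∈ w∈′ with ∈-map⁻ _ w∈ | ∈-map⁻ _ w∈′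
  ... | _ , _ , refl | _ , _ , refl = refl

countᵇ-here : ∀ x (w : List ℕ) → countᵇ x (x ∷ w) ≡ suc (countᵇ x w)
countᵇ-here x w = cong length (filter-accept (T? ∘ (_≡ᵇ x)) {x = x} {xs = w} (≡⇒≡ᵇ x x refl))

countᵇ-there : ∀ {x v} (w : List ℕ) → x ≢ v → countᵇ v (x ∷ w) ≡ countᵇ v w
countᵇ-there {x} {v} w x≢v = cong length (filter-reject (T? ∘ (_≡ᵇ v)) {x = x} {xs = w} (x≢v ∘ ≡ᵇ⇒≡ x v))

countᵇ-∷ : ∀ x v (w : List ℕ) → countᵇ v w ≤ countᵇ v (x ∷ w)
countᵇ-∷ x v w with x ≟ v
... | yes refl = ≤-trans (n≤1+n _) (≤-reflexive (sym (countᵇ-here x w)))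
... | no  x≢v  = ≤-reflexive (sym (countᵇ-there w x≢v))

countᵇ-∈ : ∀ {w} → v ∈ w → 0 < countᵇ v w
countᵇ-∈ {w = x ∷ w} (here refl) = subst (0 <_) (sym (countᵇ-here x w)) z<s
countᵇ-∈ {w = x ∷ w} (there v∈)  = ≤-trans (countᵇ-∈ v∈) (countᵇ-∷ x _ w)

countᵇ-∉ : ∀ {w} → v ∉ w → countᵇ v w ≡ 0
countᵇ-∉ {w = []}    _   = refl
countᵇ-∉ {w = x ∷ w} v∉ = trans (countᵇ-there w (λ x≡v → v∉ (here (sym x≡v)))) (countᵇ-∉ (v∉ ∘ there))

countᵇ-unique : ∀ {w} → Unique w → countᵇ v w ≤ 1
countᵇ-unique {w = []}    _         = z≤n
countᵇ-unique {v} {x ∷ w} (x∉ ∷ u) with x ≟ v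
... | yes refl = ≤-reflexive (trans (countᵇ-here x w) (cong suc (countᵇ-∉ (AllP.All¬⇒¬Any x∉))))
... | no  x≢v  = subst (_≤ 1) (sym (countᵇ-there w x≢v)) (countᵇ-unique u)

countᵇ≤1⇒Unique : ∀ {w} → (∀ {x} → x ∈ w → countᵇ x w ≤ 1) → Unique w
countᵇ≤1⇒Unique {[]}    _  = []
countᵇ≤1⇒Unique {x ∷ w} ≤1 =
  All.tabulate (λ y∈ x≡y → <⇒≱ (countᵇ-∈ (subst (_∈ w) (sym x≡y) y∈))
                              (s≤s⁻¹ (subst (_≤ 1) (countᵇ-here x w) (≤1 (here refl)))))
  ∷ countᵇ≤1⇒Unique (λ y∈ → ≤-trans (countᵇ-∷ x _ w) (≤1 (there y∈)))

isPerm⇔ : ∀ {w} → Bounded m w → T (isPerm m w) ⇔ (length w ≡ m × Unique w)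
isPerm⇔ {m} {w} bnd = mk⇔ to from
  where
  to : T (isPerm m w) → length w ≡ m × Unique w
  to p with Equivalence.to T-∧ p
  ... | len , counts = ≡ᵇ⇒≡ _ _ len , countᵇ≤1⇒Unique once
    where
    once : ∀ {x} → x ∈ w → countᵇ x w ≤ 1
    once x∈ = let 0<x , x≤m = All.lookup bnd x∈ in
      ≤-reflexive (≡ᵇ⇒≡ _ _ (All.lookup (AllP.all⁺ _ _ counts) (∈-oneTo⁺ 0<x x≤m)))
  from : length w ≡ m × Unique w → T (isPerm m w)
  from (len , u) = Equivalence.from T-∧ (≡⇒≡ᵇ _ _ len , AllP.all⁻ _ (All.tabulate once))
    where
    once : ∀ {v} → v ∈ oneTo m → T (countᵇ v w ≡ᵇ 1)
    once v∈ = let 0<v , v≤m = ∈-oneTo⁻ v∈ in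
      ≡⇒≡ᵇ _ _ (≤-antisym (countᵇ-unique u) (countᵇ-∈ (IsPermutation-∈ (mkPerm len bnd u) 0<v v≤m)))

-- isDumont1 m w unfolds to all (dumontAt m w) (upTo m).
dumontAt : ℕ → List ℕ → ℕ → Bool
dumontAt m w i = if evenᵇ (at w i)
                 then ((suc i <ᵇ m) ∧ (at w (suc i) <ᵇ at w i))
                 else ((suc i ≡ᵇ m) ∨ (at w i <ᵇ at w (suc i)))

isDumont1-∷ : ∀ m x w → isDumont1 (suc m) (x ∷ w) ≡ (dumontAt (suc m) (x ∷ w) 0 ∧ isDumont1 m w)
isDumont1-∷ m x w = cong (dumontAt (suc m) (x ∷ w) 0 ∧_)
  (trans (cong (all (dumontAt (suc m) (x ∷ w))) (sym (map-upTo suc m)))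
         (all-map (dumontAt (suc m) (x ∷ w)) suc (upTo m)))

T-Step : ∀ x y → T (if evenᵇ x then y <ᵇ x else x <ᵇ y) ⇔ Step x y
T-Step x y with evenᵇ x in e
... | true  = mk⇔ (descent e ∘ <ᵇ⇒< y x)
                  λ { (descent _ y<x) → <⇒<ᵇ y<x ; (ascent e′ _) → contradiction (trans (sym e) e′) λ () }
... | false = mk⇔ (ascent e ∘ <ᵇ⇒< x y)
                  λ { (ascent _ x<y) → <⇒<ᵇ x<y ; (descent e′ _) → contradiction (trans (sym e) e′) λ () }

isDumont1⇔ : ∀ w → T (isDumont1 (length w) w) ⇔ Dumont false w
isDumont1⇔ []          = mk⇔ _ _
isDumont1⇔ (x ∷ []) with evenᵇ x
... | true  = mk⇔ (λ ()) (λ ())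
... | false = mk⇔ (λ _ → refl) _
isDumont1⇔ (x ∷ y ∷ w) =
  ⇔.trans (subst-⇔ T (isDumont1-∷ (length (y ∷ w)) x (y ∷ w)))
          (⇔.trans T-∧ (T-Step x y ×-⇔ isDumont1⇔ (y ∷ w)))

∈-subseqs⁻ : ∀ (w : List ℕ) {s} → s ∈ subseqs w → s ⊆ w
∈-subseqs⁻ []      (here refl) = []
∈-subseqs⁻ (x ∷ w) s∈ with ∈-++⁻ (map (x ∷_) (subseqs w)) s∈
... | inj₂ s∈w = x ∷ʳ ∈-subseqs⁻ w s∈w
... | inj₁ s∈xw with ∈-map⁻ (x ∷_) s∈xw
...   | s′ , s′∈ , refl = refl ∷ ∈-subseqs⁻ w s′∈

∈-subseqs⁺ : ∀ {s w : List ℕ} → s ⊆ w → s ∈ subseqs w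
∈-subseqs⁺ []                       = here refl
∈-subseqs⁺ {w = x ∷ w} (x ∷ʳ s⊆w)   = ∈-++⁺ʳ (map (x ∷_) (subseqs w)) (∈-subseqs⁺ s⊆w)
∈-subseqs⁺             (refl ∷ s⊆w) = ∈-++⁺ˡ (∈-map⁺ (_ ∷_) (∈-subseqs⁺ s⊆w))

at-map : ∀ (f : ℕ → ℕ) xs {i} → i < length xs → at (map f xs) i ≡ f (at xs i)
at-map f (x ∷ xs) {zero}  _   = refl
at-map f (x ∷ xs) {suc i} i<n = at-map f xs (s<s⁻¹ i<n)

at-∈ : ∀ xs {i} → i < length xs → at xs i ∈ xs
at-∈ (x ∷ xs) {zero}  _   = here refl
at-∈ (x ∷ xs) {suc i} i<n = there (at-∈ xs (s<s⁻¹ i<n))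

at-strictMono : ∀ {xs i j} → AllPairs _<_ xs → i < j → j < length xs → at xs i < at xs j
at-strictMono {x ∷ xs} {zero}  {suc j} (x< ∷ _)   _   j<n = All.lookup x< (at-∈ xs (s<s⁻¹ j<n))
at-strictMono {x ∷ xs} {suc i} {suc j} (_ ∷ inc) i<j j<n = at-strictMono inc (s<s⁻¹ i<j) (s<s⁻¹ j<n)

boolEq-T : ∀ {a b} → T (boolEq a b) → T b → T a
boolEq-T {true}  _ _ = _
boolEq-T {false} {true}  () _
boolEq-T {false} {false} _ ()

T-boolEq : ∀ {a b} → (T a ⇔ T b) → T (boolEq a b)
T-boolEq {true}  {true}  _   = _
T-boolEq {true}  {false} a⇔b = Equivalence.to a⇔b _
T-boolEq {false} {true}  a⇔b = Equivalence.from a⇔b _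
T-boolEq {false} {false} _   = _

orderIso⇒< : ∀ s t → T (orderIso s t) → ∀ i j → i < length s → j < length s →
             at t i < at t j → at s i < at s j
orderIso⇒< s t iso i j i<n j<n ti<tj = <ᵇ⇒< _ _ (boolEq-T entry (<⇒<ᵇ ti<tj))
  where
  row : T (all (λ j → boolEq (at s i <ᵇ at s j) (at t i <ᵇ at t j)) (upTo (length s)))
  row = All.lookup (AllP.all⁺ _ _ (proj₂ (Equivalence.to T-∧ iso))) (∈-upTo⁺ i<n)
  entry : T (boolEq (at s i <ᵇ at s j) (at t i <ᵇ at t j))
  entry = All.lookup (AllP.all⁺ _ _ row) (∈-upTo⁺ j<n)

orderIso-map : ∀ (f : ℕ → ℕ) t → (∀ {x y} → x ∈ t → y ∈ t → x < y → f x < f y) →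
               T (orderIso (map f t) t)
orderIso-map f t mono = Equivalence.from T-∧
  (≡⇒≡ᵇ _ _ (length-map f t) , AllP.all⁻ _ (All.tabulate λ i∈ → AllP.all⁻ _ (All.tabulate λ j∈ →
     entry (subst (_ <_) (length-map f t) (∈-upTo⁻ i∈)) (subst (_ <_) (length-map f t) (∈-upTo⁻ j∈)))))
  where
  reflects : ∀ {x y} → x ∈ t → y ∈ t → f x < f y → x < y
  reflects {x} {y} x∈ y∈ fx<fy with <-cmp x y
  ... | tri< x<y _ _ = x<y
  ... | tri≈ _ refl _ = contradiction fx<fy (<-irrefl refl)
  ... | tri> _ _ y<x = contradiction fx<fy (<-asym (mono y∈ x∈ y<x))
  entry : ∀ {i j} → i < length t → j < length t →
          T (boolEq (at (map f t) i <ᵇ at (map f t) j) (at t i <ᵇ at t j))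
  entry {i} {j} i<n j<n rewrite at-map f t i<n | at-map f t j<n = T-boolEq (mk⇔
    (<⇒<ᵇ ∘ reflects (at-∈ t i<n) (at-∈ t j<n) ∘ <ᵇ⇒< _ _)
    (<⇒<ᵇ ∘ mono (at-∈ t i<n) (at-∈ t j<n) ∘ <ᵇ⇒< _ _))

orderIso-rank : ∀ sorted t → AllPairs _<_ sorted → Bounded (length sorted) t →
                T (orderIso (map (λ i → at sorted (pred i)) t) t)
orderIso-rank sorted t increasing bnd = orderIso-map _ t mono
  where
  mono : ∀ {x y} → x ∈ t → y ∈ t → x < y → at sorted (pred x) < at sorted (pred y)
  mono x∈ y∈ x<y with All.lookup bnd x∈ | All.lookup bnd y∈
  ... | z<s , _ | z<s , y≤n = at-strictMono increasing (s<s⁻¹ x<y) y≤n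

bounded? : ∀ m w → Dec (Bounded m w)
bounded? m = All.all? λ x → (0 <? x) ×-dec (x ≤? m)

p4213 p1342 : List ℕ
p4213 = 4 ∷ 2 ∷ 1 ∷ 3 ∷ []
p1342 = 1 ∷ 3 ∷ 4 ∷ 2 ∷ []

orderIso⇔4213 : ∀ {a b c d} → T (orderIso (a ∷ b ∷ c ∷ d ∷ []) p4213) ⇔ Pattern4213 a b c d
orderIso⇔4213 {a} {b} {c} {d} = mk⇔
  (λ iso → let lt = orderIso⇒< (a ∷ b ∷ c ∷ d ∷ []) p4213 iso in
     lt 2 1 (<ᵇ⇒< _ _ _) (<ᵇ⇒< _ _ _) (<ᵇ⇒< _ _ _) ,
     lt 1 3 (<ᵇ⇒< _ _ _) (<ᵇ⇒< _ _ _) (<ᵇ⇒< _ _ _) ,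
     lt 3 0 (<ᵇ⇒< _ _ _) (<ᵇ⇒< _ _ _) (<ᵇ⇒< _ _ _))
  (λ (c<b , b<d , d<a) → orderIso-rank (c ∷ b ∷ d ∷ a ∷ []) p4213
     (Linked⇒AllPairs <-trans (c<b ∷ b<d ∷ d<a ∷ [-])) (from-yes (bounded? 4 p4213)))

orderIso⇔1342 : ∀ {a b c d} → T (orderIso (a ∷ b ∷ c ∷ d ∷ []) p1342) ⇔ Pattern1342 a b c d
orderIso⇔1342 {a} {b} {c} {d} = mk⇔
  (λ iso → let lt = orderIso⇒< (a ∷ b ∷ c ∷ d ∷ []) p1342 iso in
     lt 0 3 (<ᵇ⇒< _ _ _) (<ᵇ⇒< _ _ _) (<ᵇ⇒< _ _ _) ,
     lt 3 1 (<ᵇ⇒< _ _ _) (<ᵇ⇒< _ _ _) (<ᵇ⇒< _ _ _) ,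
     lt 1 2 (<ᵇ⇒< _ _ _) (<ᵇ⇒< _ _ _) (<ᵇ⇒< _ _ _))
  (λ (a<d , d<b , b<c) → orderIso-rank (a ∷ d ∷ b ∷ c ∷ []) p1342
     (Linked⇒AllPairs <-trans (a<d ∷ d<b ∷ b<c ∷ [-])) (from-yes (bounded? 4 p1342)))

length≡4 : ∀ (s : List ℕ) → length s ≡ 4 → ∃ λ a → ∃ λ b → ∃ λ c → ∃ λ d → s ≡ a ∷ b ∷ c ∷ d ∷ []
length≡4 (a ∷ b ∷ c ∷ d ∷ []) refl = a , b , c , d , refl

contains⇔ : ∀ τ {P} → length τ ≡ 4 → (∀ {a b c d} → T (orderIso (a ∷ b ∷ c ∷ d ∷ []) τ) ⇔ P a b c d) →
            ∀ w → T (contains τ w) ⇔ Occurs P w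
contains⇔ τ {P} len iso w = mk⇔ to from
  where
  to : T (contains τ w) → Occurs P w
  to c with find (AnyP.any⁻ _ (subseqs w) c)
  ... | s , s∈ , oi with length≡4 s (trans (≡ᵇ⇒≡ _ _ (proj₁ (Equivalence.to T-∧ oi))) len)
  ...   | a , b , c , d , refl = a , b , c , d , ∈-subseqs⁻ w s∈ , Equivalence.to iso oi
  from : Occurs P w → T (contains τ w)
  from (a , b , c , d , s⊆w , pat) = AnyP.any⁺ _ (lose (∈-subseqs⁺ s⊆w) (Equivalence.from iso pat))

T-not : ∀ b → T (not b) ⇔ (¬ T b)
T-not true  = mk⇔ (λ ()) (λ ¬t → ¬t _)
T-not false = mk⇔ (λ _ ()) _

avoids⇔ : ∀ τ {P} → length τ ≡ 4 → (∀ {a b c d} → T (orderIso (a ∷ b ∷ c ∷ d ∷ []) τ) ⇔ P a b c d) →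
          ∀ w → T (avoids τ w) ⇔ (¬ Occurs P w)
avoids⇔ τ len iso w = mk⇔
  (λ av → Equivalence.to (T-not (contains τ w)) av ∘ Equivalence.from (contains⇔ τ len iso w))
  (λ ¬occ → Equivalence.from (T-not (contains τ w)) (¬occ ∘ Equivalence.to (contains⇔ τ len iso w)))

dumont1List : List ℕ → ℕ → List (List ℕ)
dumont1List τ n =
  filterᵇ (λ w → isPerm (2 * n) w ∧ isDumont1 (2 * n) w ∧ avoids τ w) (words (2 * n) (2 * n))

dumont1List-unique : ∀ τ n → Unique (dumont1List τ n)
dumont1List-unique τ n = Unique.filter⁺ _ (words-unique (2 * n) (2 * n))

∈-dumont1List⇔ : ∀ τ {P} → length τ ≡ 4 →
                 (∀ {a b c d} → T (orderIso (a ∷ b ∷ c ∷ d ∷ []) τ) ⇔ P a b c d) →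
                 ∀ n {w} → w ∈ dumont1List τ n ⇔ 𝔇¹ P n w
∈-dumont1List⇔ τ {P} len iso n {w} = mk⇔ to from
  where
  N : ℕ
  N = 2 * n
  test : List ℕ → Bool
  test w = isPerm N w ∧ isDumont1 N w ∧ avoids τ w
  to : w ∈ dumont1List τ n → 𝔇¹ P n w
  to w∈ with ∈-filter⁻ (T? ∘ test) w∈
  ... | w∈words , t with ∈-words⁻ N N w∈words | Equivalence.to T-∧ t
  ...   | lenW , bnd | isP , rest with Equivalence.to T-∧ rest | Equivalence.to (isPerm⇔ bnd) isP
  ...     | isD , av | _ , u =
    mk𝔇¹ (mkPerm lenW bnd u)
         (Equivalence.to (isDumont1⇔ w) (subst (λ m → T (isDumont1 m w)) (sym lenW) isD))
         (Equivalence.to (avoids⇔ τ len iso w) av)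
  from : 𝔇¹ P n w → w ∈ dumont1List τ n
  from (mk𝔇¹ (mkPerm lenN bnd u) dum av) = ∈-filter⁺ (T? ∘ test)
    (subst (λ k → w ∈ words N k) lenN (∈-words⁺ N bnd))
    (Equivalence.from T-∧ (Equivalence.from (isPerm⇔ bnd) (lenN , u) , Equivalence.from T-∧
      (subst (λ m → T (isDumont1 m w)) lenN (Equivalence.from (isDumont1⇔ w) dum) ,
       Equivalence.from (avoids⇔ τ len iso w) av)))

-- Counting

𝒜 ℬ : ℕ → List (List ℕ)
𝒜 = dumont1List p4213
ℬ = dumont1List p1342

∈𝒜⇔ : ∀ n {w} → w ∈ 𝒜 n ⇔ 𝔇¹ Pattern4213 n w
∈𝒜⇔ = ∈-dumont1List⇔ p4213 refl orderIso⇔4213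

∈ℬ⇔ : ∀ n {w} → w ∈ ℬ n ⇔ 𝔇¹ Pattern1342 n w
∈ℬ⇔ = ∈-dumont1List⇔ p1342 refl orderIso⇔1342

block : ℕ → ℕ → List (List ℕ)
block n k = cartesianProductWith (assemble k) (ℬ k) (𝒜 (n ∸ k))

assembled : ℕ → List (List ℕ)
assembled n = concatMap (block n) (upTo (suc n))

length-assembled : ∀ n → length (assembled n) ≡ sum (map (λ k → bSeq k * aSeq (n ∸ k)) (upTo (suc n)))
length-assembled n = trans (length-concatMap (block n) (upTo (suc n)))
  (cong sum (map-cong (λ k → length-cartesianProductWith (assemble k) (ℬ k) (𝒜 (n ∸ k))) (upTo (suc n))))

∈-block⁻ : ∀ n k {w} → w ∈ block n k →
               ∃ λ β → ∃ λ τ → 𝔇¹ Pattern1342 k β × 𝔇¹ Pattern4213 (n ∸ k) τ × w ≡ assemble k β τ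
∈-block⁻ n k w∈ with ∈-cartesianProductWith⁻ (assemble k) (ℬ k) (𝒜 (n ∸ k)) w∈
... | β , τ , β∈ , τ∈ , refl = β , τ , Equivalence.to (∈ℬ⇔ k) β∈ , Equivalence.to (∈𝒜⇔ (n ∸ k)) τ∈ , refl

assembled-unique : ∀ n → Unique (assembled n)
assembled-unique n = Unique-concatMap⁺ {f = block n} (Unique.upTo⁺ (suc n)) blockUnique sameBlock
  where
  perm : ∀ k {β} → β ∈ ℬ k → IsPermutation (2 * k) β
  perm k = 𝔇¹.perm ∘ Equivalence.to (∈ℬ⇔ k)
  blockUnique : ∀ {k} → k ∈ upTo (suc n) → Unique (block n k)
  blockUnique {k} _ = Unique-cartesianProductWith⁺ {f = assemble k}
    (λ β∈ β′∈ _ _ → proj₂ ∘ assemble-injective {k = k} {k′ = k} (perm k β∈) (perm k β′∈))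
    (dumont1List-unique p1342 k) (dumont1List-unique p4213 (n ∸ k))
  sameBlock : ∀ {k k′ w} → k ∈ upTo (suc n) → k′ ∈ upTo (suc n) →
              w ∈ block n k → w ∈ block n k′ → k ≡ k′
  sameBlock {k} {k′} _ _ w∈ w∈′ with ∈-block⁻ n k w∈ | ∈-block⁻ n k′ w∈′
  ... | _ , _ , β , _ , refl | _ , _ , β′ , _ , eq = proj₁ (assemble-injective (𝔇¹.perm β) (𝔇¹.perm β′) eq)

assembled⊆𝒜 : ∀ n {w} → w ∈ assembled n → w ∈ 𝒜 (suc n)
assembled⊆𝒜 n w∈ with find (∈-concatMap⁻ (block n) {xs = upTo (suc n)} w∈)
... | k , k∈ , w∈k with ∈-block⁻ n k w∈k
...   | β , τ , β𝔇 , τ𝔇 , refl = Equivalence.from (∈𝒜⇔ (suc n)) (assemble-𝔇¹ (s≤s⁻¹ (∈-upTo⁻ k∈)) β𝔇 τ𝔇)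

𝒜⊆assembled : ∀ n {w} → w ∈ 𝒜 (suc n) → w ∈ assembled n
𝒜⊆assembled n w∈ with disassemble (Equivalence.to (∈𝒜⇔ (suc n)) w∈)
... | k , k≤n , β , τ , β𝔇 , τ𝔇 , refl = ∈-concatMap⁺ (block n) (lose (∈-upTo⁺ (s≤s k≤n))
  (∈-cartesianProductWith⁺ (assemble k) (Equivalence.from (∈ℬ⇔ k) β𝔇) (Equivalence.from (∈𝒜⇔ (n ∸ k)) τ𝔇)))

aSeq-suc : ∀ n → aSeq (suc n) ≡ sum (map (λ k → bSeq k * aSeq (n ∸ k)) (upTo (suc n)))
aSeq-suc n = trans (≤-antisym (pigeonhole (dumont1List-unique p4213 (suc n)) (𝒜⊆assembled n))
                              (pigeonhole (assembled-unique n) (assembled⊆𝒜 n)))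
                   (length-assembled n)

lemma3p3 : (aSeq 0 ≡ 1)
    × ((n : ℕ) → aSeq (suc n) ≡ sum (map (λ k → bSeq k * aSeq (n ∸ k)) (upTo (suc n))))
lemma3p3 = refl , aSeq-suc
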